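{- Every connected threshold graph on $n\geq 2$ vertices is isomorphic to an induced subgraph of the anti-regular graph $A_{2n-2}$. More precisely, let $G$ be a connected threshold graph with binary string $b=0^{s_1}1^{t_1}\cdots 0^{s_k}1^{t_k}$ (all $s_i,t_i\geq 1$) and $n=\sum_{i=1}^k(s_i+t_i)$ vertices. Let $N=2(n-k)$ if $s_1=1$ and $N=2(n-k)-1$ if $s_1\geq 2$. Then $G$ is isomorphic to an induced subgraph of $A_N$, and $A_N$ is the smallest anti-regular graph containing $G$ as an induced subgraph.
   Context: For a binary string $b=b_1b_2\cdots b_n$ with $b_1=0$, the threshold graph $G(b)$ is constructed as follows: start with a single vertex $v_1$; for $j=2,\ldots,n$ add a new vertex $v_j$ which is adjacent to all of $v_1,\ldots,v_{j-1}$ if $b_j=1$ and to none of them if $b_j=0$. Every threshold graph is of this form, and $G(b)$ is connected iff $b_n=1$; thus a connected threshold graph on $n\geq2$ vertices has a binary string of the form $b=0^{s_1}1^{t_1}\cdots 0^{s_k}1^{t_k}$ with all $s_i,t_i\geq1$, where $0^{s}$ (resp. $1^t$) denotes $s$ consecutive zeros (resp. $t$ consecutive ones); this is the binary string of $G$. For $N\geq 2$, the anti-regular graph $A_N$ is $G(0101\cdots01)$ (alternating string of length $N$) when $N$ is even and $G(00101\cdots 01)$ (length $N$) when $N$ is odd; equivalently, $A_N$ is the unique connected graph on $N$ vertices whose degree sequence has exactly $N-1$ distinct values. -}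

module Defs where

open import Data.Bool using (Bool; true; false; if_then_else_)
open import Data.Nat using (ℕ; zero; suc; _+_; _*_; _∸_; _≡ᵇ_; _<ᵇ_; _%_; ⌊_/2⌋)
open import Data.Fin using (Fin; toℕ)
open import Data.List using (List; []; _∷_; [_]; _++_; replicate; concatMap; length; lookup; map)
open import Data.Nat.ListAction using (sum)
open import Data.Product using (_×_; _,_; proj₁; proj₂; Σ)
open import Relation.Binary.PropositionalEquality using (_≡_)
open import Function.Definitions using (Injective)

record Graph : Set where
  field
    size : ℕ
    adj  : Fin size → Fin size → Bool
open Graph public

-- The threshold graph G(b) of a binary string b = b_1 … b_n (0-indexed here):
-- for positions i < j, v_i ~ v_j iff b_j = 1 (v_j joined to all earlier vertices).
-- No loops.
thresholdGraph : List Bool → Graph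
thresholdGraph b = record
  { size = length b
  ; adj  = λ i j → if toℕ i <ᵇ toℕ j then lookup b j
                   else (if toℕ j <ᵇ toℕ i then lookup b i else false) }

IsoToInducedSubgraph : Graph → Graph → Set
IsoToInducedSubgraph G H =
  Σ (Fin (size G) → Fin (size H)) λ f →
    Injective _≡_ _≡_ f × (∀ i j → adj G i j ≡ adj H (f i) (f j))

alt01 : ℕ → List Bool
alt01 zero    = []
alt01 (suc m) = false ∷ true ∷ alt01 m

antiRegularString : ℕ → List Bool
antiRegularString N =
  (if N % 2 ≡ᵇ 0 then [] else [ false ]) ++ alt01 ⌊ N /2⌋

-- anti-regular graph A_N (meaningful for N ≥ 2)
A : ℕ → Graph
A N = thresholdGraph (antiRegularString N)

blocksString : List (ℕ × ℕ) → List Bool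
blocksString = concatMap (λ p → replicate (proj₁ p) false ++ replicate (proj₂ p) true)

blocksSize : List (ℕ × ℕ) → ℕ
blocksSize bs = sum (map (λ p → proj₁ p + proj₂ p) bs)

targetN : (s₁ n k : ℕ) → ℕ
targetN s₁ n k = if s₁ ≡ᵇ 1 then 2 * (n ∸ k) else 2 * (n ∸ k) ∸ 1

module Submission where

-- If the string b is a sublist of c then G(b) is an induced
-- subgraph of G(c) (`sublist⇒↪`).  A block 0^s 1^t fits into (01)^{s+t-1},
-- which places the string of G inside the string of A_N (`G↪A-target`).
-- The strings of A_N, A_{N+1}, … are sublists of each other (`A-mono`),
-- which gives the embedding into A_{2n-2}, as N ≤ 2n - 2.
--
-- A_M has distinct weights in [1, M] (read from the last
-- vertex backwards: M, 1, M-1, 2, …) such that two vertices are adjacent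
-- iff their weights sum beyond M (`A-realization`); this restricts to every
-- induced subgraph.  For such a weighting, a graph whose vertices fall into
-- K twin classes has 2n ≤ M + K + 1 (`TwinCounting`), and G has 2k twin
-- classes, or 2k - 1 when s₁ = 1 (`A-minimal`).

open import Defs
open import Data.Bool using (Bool; true; false; not; if_then_else_)
open import Data.Nat
  using (ℕ; zero; suc; pred; _+_; _∸_; _*_; _%_; _≡ᵇ_; _<ᵇ_; _≟_; _≤?_; _<?_; >-nonZero;
         _≤_; _<_; _≤′_; ≤′-refl; ≤′-step; z≤n; s≤s; s≤s⁻¹; z<s; s<s)
open import Data.Nat.Properties
open import Data.Fin using (Fin; toℕ; fromℕ<; splitAt; join)
open import Data.Fin.Properties
  using (toℕ-fromℕ<; toℕ-injective; toℕ<n; injective⇒≤; any?; all?; ¬∀⟶∃¬; join-splitAt)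
  renaming (_≟_ to _≟ᶠ_)
open import Data.List using (List; []; _∷_; _++_; length; lookup; replicate)
open import Data.List.Properties using (++-assoc; length-++; length-replicate)
open import Data.List.Relation.Unary.All using (All; []; _∷_)
open import Data.List.Relation.Binary.Sublist.Propositional using (_⊆_; []; _∷_; _∷ʳ_; ⊆-refl)
open import Data.Product using (Σ; _×_; _,_; proj₁; proj₂)
open import Data.Empty using (⊥; ⊥-elim)
open import Data.Sum using (_⊎_; inj₁; inj₂)
open import Relation.Nullary using (¬_; yes; no)
open import Relation.Nullary.Decidable using (_→-dec_)
open import Function.Bundles using (_⇔_; mk⇔; Equivalence)
open import Relation.Binary.PropositionalEquality
open import Relation.Binary.Definitions using (tri<; tri≈; tri>)

_↪_ : Graph → Graph → Set
G ↪ H = IsoToInducedSubgraph G H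

↪-trans : ∀ {G H K} → G ↪ H → H ↪ K → G ↪ K
↪-trans (f , f-inj , f-adj) (g , g-inj , g-adj) =
  (λ i → g (f i)) , (λ e → f-inj (g-inj e)) , (λ i j → trans (f-adj i j) (g-adj (f i) (f j)))

_↪ᵗ_ : List Bool → List Bool → Set
b ↪ᵗ c = thresholdGraph b ↪ thresholdGraph c

-- The letter at position j of a string (false beyond its end).
letter : List Bool → ℕ → Bool
letter []       _       = false
letter (x ∷ xs) zero    = x
letter (x ∷ xs) (suc j) = letter xs j

lookup≡letter : ∀ c (i : Fin (length c)) → lookup c i ≡ letter c (toℕ i)
lookup≡letter (x ∷ c) Fin.zero    = refl
lookup≡letter (x ∷ c) (Fin.suc i) = lookup≡letter c i

linked : List Bool → ℕ → ℕ → Bool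
linked c i j = if i <ᵇ j then letter c j else (if j <ᵇ i then letter c i else false)

adj≡linked : ∀ c (i j : Fin (length c)) → adj (thresholdGraph c) i j ≡ linked c (toℕ i) (toℕ j)
adj≡linked c i j rewrite lookup≡letter c i | lookup≡letter c j = refl

<ᵇ-true : ∀ {i j} → i < j → (i <ᵇ j) ≡ true
<ᵇ-true {zero}  {suc j} _       = refl
<ᵇ-true {suc i} {suc j} (s≤s p) = <ᵇ-true p

<ᵇ-false : ∀ {i j} → j ≤ i → (i <ᵇ j) ≡ false
<ᵇ-false {i}     {zero}  _       = refl
<ᵇ-false {suc i} {suc j} (s≤s p) = <ᵇ-false p

linked-< : ∀ c {i j} → i < j → linked c i j ≡ letter c j
linked-< c i<j rewrite <ᵇ-true i<j = refl

linked-> : ∀ c {i j} → j < i → linked c i j ≡ letter c i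
linked-> c j<i rewrite <ᵇ-false (<⇒≤ j<i) | <ᵇ-true j<i = refl

linked-irrefl : ∀ c i → linked c i i ≡ false
linked-irrefl c i rewrite <ᵇ-false (≤-refl {i}) = refl

-- A strictly increasing map of positions that preserves letters makes G(b)
-- an induced subgraph of G(c): in both graphs the later endpoint decides.
monotone⇒↪ : (b c : List Bool) (F : ℕ → ℕ) →
  (∀ j → j < length b → F j < length c) →
  (∀ i j → i < j → j < length b → F i < F j) →
  (∀ j → j < length b → letter c (F j) ≡ letter b j) →
  thresholdGraph b ↪ thresholdGraph c
monotone⇒↪ b c F F-range F-mono F-letter = f , f-injective , f-adj
  where
  f : Fin (length b) → Fin (length c)
  f i = fromℕ< (F-range (toℕ i) (toℕ<n i))

  toℕ-f : ∀ i → toℕ (f i) ≡ F (toℕ i)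
  toℕ-f i = toℕ-fromℕ< (F-range (toℕ i) (toℕ<n i))

  F-<-on : ∀ i j → toℕ i < toℕ j → toℕ (f i) < toℕ (f j)
  F-<-on i j i<j rewrite toℕ-f i | toℕ-f j = F-mono _ _ i<j (toℕ<n j)

  f-injective : ∀ {i j} → f i ≡ f j → i ≡ j
  f-injective {i} {j} e with <-cmp (toℕ i) (toℕ j)
  ... | tri< i<j _ _ = ⊥-elim (<-irrefl (cong toℕ e) (F-<-on i j i<j))
  ... | tri≈ _ i≡j _ = toℕ-injective i≡j
  ... | tri> _ _ j<i = ⊥-elim (<-irrefl (cong toℕ (sym e)) (F-<-on j i j<i))

  f-adj : ∀ i j → adj (thresholdGraph b) i j ≡ adj (thresholdGraph c) (f i) (f j)
  f-adj i j rewrite adj≡linked b i j | adj≡linked c (f i) (f j) with <-cmp (toℕ i) (toℕ j)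
  ... | tri< i<j _ _ = begin
    linked b (toℕ i) (toℕ j)         ≡⟨ linked-< b i<j ⟩
    letter b (toℕ j)                 ≡⟨ sym (F-letter _ (toℕ<n j)) ⟩
    letter c (F (toℕ j))             ≡⟨ cong (letter c) (sym (toℕ-f j)) ⟩
    letter c (toℕ (f j))             ≡⟨ sym (linked-< c (F-<-on i j i<j)) ⟩
    linked c (toℕ (f i)) (toℕ (f j)) ∎
    where open ≡-Reasoning
  ... | tri> _ _ j<i = begin
    linked b (toℕ i) (toℕ j)         ≡⟨ linked-> b j<i ⟩
    letter b (toℕ i)                 ≡⟨ sym (F-letter _ (toℕ<n i)) ⟩
    letter c (F (toℕ i))             ≡⟨ cong (letter c) (sym (toℕ-f i)) ⟩
    letter c (toℕ (f i))             ≡⟨ sym (linked-> c (F-<-on j i j<i)) ⟩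
    linked c (toℕ (f i)) (toℕ (f j)) ∎
    where open ≡-Reasoning
  ... | tri≈ _ i≡j _ rewrite toℕ-injective i≡j =
    trans (linked-irrefl b (toℕ j)) (sym (linked-irrefl c (toℕ (f j))))

position : ∀ {b c : List Bool} → b ⊆ c → ℕ → ℕ
position []         j       = j
position (y ∷ʳ σ)   j       = suc (position σ j)
position (_ ∷ σ)    zero    = zero
position (_ ∷ σ)    (suc j) = suc (position σ j)

sublist⇒↪ : ∀ {b c} → b ⊆ c → thresholdGraph b ↪ thresholdGraph c
sublist⇒↪ {b} {c} σ = monotone⇒↪ b c (position σ) (range σ) (mono σ) (letters σ)
  where
  range : ∀ {b c} (σ : b ⊆ c) j → j < length b → position σ j < length c
  range (y ∷ʳ σ)  j       p       = s≤s (range σ j p)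
  range (_ ∷ σ)   zero    _       = z<s
  range (_ ∷ σ)   (suc j) (s≤s p) = s≤s (range σ j p)

  mono : ∀ {b c} (σ : b ⊆ c) i j → i < j → j < length b → position σ i < position σ j
  mono (y ∷ʳ σ) i       j       p       q       = s≤s (mono σ i j p q)
  mono (_ ∷ σ)  zero    (suc j) _       _       = z<s
  mono (_ ∷ σ)  (suc i) (suc j) (s≤s p) (s≤s q) = s≤s (mono σ i j p q)

  letters : ∀ {b c} (σ : b ⊆ c) j → j < length b → letter c (position σ j) ≡ letter b j
  letters (y ∷ʳ σ)  j       p       = letters σ j p
  letters (refl ∷ σ) zero   _       = refl
  letters (_ ∷ σ)   (suc j) (s≤s p) = letters σ j p

data Parity : ℕ → Set where
  even : ∀ m → Parity (m + m)
  odd  : ∀ m → Parity (suc (m + m))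

parity : ∀ n → Parity n
parity zero = even 0
parity (suc n) with parity n
... | even m = odd m
... | odd m  = subst Parity (cong suc (+-suc m m)) (even (suc m))

double%2 : ∀ m → (m + m) % 2 ≡ 0
double%2 zero    = refl
double%2 (suc m) rewrite +-suc m m = double%2 m

double+1%2 : ∀ m → suc (m + m) % 2 ≡ 1
double+1%2 zero    = refl
double+1%2 (suc m) rewrite +-suc m m = double+1%2 m

ars-even : ∀ m → antiRegularString (m + m) ≡ alt01 m
ars-even m rewrite double%2 m | sym (n≡⌊n+n/2⌋ m) = refl

ars-odd : ∀ m → antiRegularString (suc (m + m)) ≡ false ∷ alt01 m
ars-odd m rewrite double+1%2 m | sym (n≡⌈n+n/2⌉ m) = refl

length-alt01 : ∀ m → length (alt01 m) ≡ m + m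
length-alt01 zero    = refl
length-alt01 (suc m) rewrite +-suc m m = cong (λ l → suc (suc l)) (length-alt01 m)

size-A : ∀ M → length (antiRegularString M) ≡ M
size-A M with parity M
... | even m rewrite ars-even m = length-alt01 m
... | odd m  rewrite ars-odd m  = cong suc (length-alt01 m)

A-step : ∀ N → A N ↪ A (suc N)
A-step N with parity N
... | even m = subst₂ _↪ᵗ_ (sym (ars-even m)) (sym (ars-odd m)) (sublist⇒↪ (false ∷ʳ ⊆-refl))
... | odd m  = subst₂ _↪ᵗ_ (sym (ars-odd m)) (sym ars-next)
                 (sublist⇒↪ (refl ∷ (true ∷ʳ ⊆-refl)))
  where
  ars-next : antiRegularString (suc (suc (m + m))) ≡ alt01 (suc m)
  ars-next = trans (cong (λ k → antiRegularString (suc k)) (sym (+-suc m m))) (ars-even (suc m))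

A-mono : ∀ {N M} → N ≤ M → A N ↪ A M
A-mono N≤M = chain (≤⇒≤′ N≤M)
  where
  chain : ∀ {N M} → N ≤′ M → A N ↪ A M
  chain {N} ≤′-refl = sublist⇒↪ {antiRegularString N} ⊆-refl
  chain {N} {suc M} (≤′-step N≤M) = ↪-trans {A N} {A M} {A (suc M)} (chain N≤M) (A-step M)

alt01-+ : ∀ a b → alt01 (a + b) ≡ alt01 a ++ alt01 b
alt01-+ zero    b = refl
alt01-+ (suc a) b = cong (λ l → false ∷ true ∷ l) (alt01-+ a b)

-- A run of zeros is absorbed by an alternating string: one "01" per extra zero.
zeros⊆alt : ∀ s {b c} → false ∷ b ⊆ c → false ∷ (replicate s false ++ b) ⊆ alt01 s ++ c
zeros⊆alt zero    σ = σ
zeros⊆alt (suc s) σ = refl ∷ (true ∷ʳ zeros⊆alt s σ)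

-- Likewise for a run of ones, one "01" per extra one.
ones⊆alt : ∀ t {b c} → b ⊆ c → true ∷ (replicate t true ++ b) ⊆ true ∷ (alt01 t ++ c)
ones⊆alt zero    σ = refl ∷ σ
ones⊆alt (suc t) σ = refl ∷ (false ∷ʳ ones⊆alt t σ)

block⊆alt : ∀ s t {b c} → b ⊆ c →
  (replicate (suc s) false ++ replicate (suc t) true) ++ b ⊆ alt01 (s + suc t) ++ c
block⊆alt s t {b} {c} σ
  rewrite ++-assoc (replicate (suc s) false) (replicate (suc t) true) b
        | alt01-+ s (suc t) | ++-assoc (alt01 s) (alt01 (suc t)) c
  = zeros⊆alt s (refl ∷ ones⊆alt t σ)

ValidBlock : ℕ × ℕ → Set
ValidBlock p = 1 ≤ proj₁ p × 1 ≤ proj₂ p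

-- The excess Σᵢ (sᵢ + tᵢ - 1) of a block list; it is n - k (n vertices, k blocks).
excess : List (ℕ × ℕ) → ℕ
excess []             = 0
excess ((s , t) ∷ bs) = (s + t ∸ 1) + excess bs

size≡excess+length : ∀ bs → All ValidBlock bs → blocksSize bs ≡ excess bs + length bs
size≡excess+length [] [] = refl
size≡excess+length ((suc s , suc t) ∷ bs) ((s≤s _ , s≤s _) ∷ valid) = begin
  suc (s + suc t) + blocksSize bs           ≡⟨ cong (suc (s + suc t) +_) (size≡excess+length bs valid) ⟩
  suc (s + suc t) + (excess bs + length bs) ≡⟨ sym (+-assoc (suc (s + suc t)) (excess bs) (length bs)) ⟩
  suc (s + suc t + excess bs) + length bs   ≡⟨ sym (+-suc (s + suc t + excess bs) (length bs)) ⟩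
  s + suc t + excess bs + suc (length bs)   ∎
  where open ≡-Reasoning

blocks⊆alt : ∀ bs → All ValidBlock bs → blocksString bs ⊆ alt01 (excess bs)
blocks⊆alt []                       []                          = []
blocks⊆alt ((suc s , suc t) ∷ bs) ((s≤s _ , s≤s _) ∷ valid) =
  subst (blocksString ((suc s , suc t) ∷ bs) ⊆_) (sym (alt01-+ (s + suc t) (excess bs)))
        (block⊆alt s t (blocks⊆alt bs valid))

size∸length≡excess : ∀ bs → All ValidBlock bs → blocksSize bs ∸ length bs ≡ excess bs
size∸length≡excess bs valid =
  trans (cong (_∸ length bs) (size≡excess+length bs valid)) (m+n∸n≡m (excess bs) (length bs))

-- The strings of A_{2e} and A_{2e+1}, in the form in which N occurs in the theorem.
ars-twice : ∀ e → antiRegularString (2 * e) ≡ alt01 e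
ars-twice e = trans (cong (λ k → antiRegularString (e + k)) (+-identityʳ e)) (ars-even e)

ars-twice-1 : ∀ e → antiRegularString (2 * suc e ∸ 1) ≡ false ∷ alt01 e
ars-twice-1 e = trans (cong antiRegularString length-eq) (ars-odd e)
  where
  length-eq : 2 * suc e ∸ 1 ≡ suc (e + e)
  length-eq = trans (+-suc e (e + 0)) (cong (λ k → suc (e + k)) (+-identityʳ e))

-- For s₁ = 1 the
-- string sits inside (01)^{n-k}; for s₁ ≥ 2 its tail sits inside (01)^{n-k-1}
-- and its leading 0 is matched by the leading 0 of 0(01)^{n-k-1}.
G↪A-target : ∀ s t rest → 1 ≤ s → 1 ≤ t → All ValidBlock rest →
  let bs = (s , t) ∷ rest in
  thresholdGraph (blocksString bs) ↪ A (targetN s (blocksSize bs) (length bs))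
G↪A-target (suc zero) t rest _ 1≤t valid =
  subst (λ N → blocksString bs ↪ᵗ antiRegularString (2 * N))
        (sym (size∸length≡excess bs bs-valid))
    (subst (blocksString bs ↪ᵗ_) (sym (ars-twice (excess bs))) (sublist⇒↪ (blocks⊆alt bs bs-valid)))
  where
  bs = (1 , t) ∷ rest
  bs-valid : All ValidBlock bs
  bs-valid = (≤-refl , 1≤t) ∷ valid
G↪A-target (suc (suc s)) t rest _ 1≤t valid =
  subst (λ N → blocksString bs ↪ᵗ antiRegularString (2 * N ∸ 1))
        (sym (size∸length≡excess bs bs-valid))
    (subst (blocksString bs ↪ᵗ_) (sym (ars-twice-1 (excess tail-bs)))
      (sublist⇒↪ (refl ∷ blocks⊆alt tail-bs tail-valid)))
  where
  bs      = (suc (suc s) , t) ∷ rest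
  tail-bs = (suc s , t) ∷ rest
  bs-valid : All ValidBlock bs
  bs-valid = (s≤s z≤n , 1≤t) ∷ valid
  tail-valid : All ValidBlock tail-bs
  tail-valid = (s≤s z≤n , 1≤t) ∷ valid

targetN≤2n-2 : ∀ s n k → 1 ≤ k → targetN s n k ≤ 2 * n ∸ 2
targetN≤2n-2 s n k 1≤k = by-case (s ≡ᵇ 1)
  where
  twice-bound : 2 * (n ∸ k) ≤ 2 * n ∸ 2
  twice-bound = subst (2 * (n ∸ k) ≤_) (*-distribˡ-∸ 2 n 1) (*-monoʳ-≤ 2 (∸-monoʳ-≤ n 1≤k))

  by-case : ∀ b → (if b then 2 * (n ∸ k) else 2 * (n ∸ k) ∸ 1) ≤ 2 * n ∸ 2
  by-case true  = twice-bound
  by-case false = ≤-trans (m∸n≤m (2 * (n ∸ k)) 1) twice-bound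

isEven : ℕ → Bool
isEven zero          = true
isEven (suc zero)    = false
isEven (suc (suc n)) = isEven n

isEven-even : ∀ r → isEven (r + r) ≡ true
isEven-even zero    = refl
isEven-even (suc r) rewrite +-suc r r = isEven-even r

isEven-odd : ∀ r → isEven (suc (r + r)) ≡ false
isEven-odd zero    = refl
isEven-odd (suc r) rewrite +-suc r r = isEven-odd r

letter-alt01 : ∀ m p e → p + suc e ≡ m + m → letter (alt01 m) p ≡ isEven e
letter-alt01 zero    p e eq = ⊥-elim (1+n≢0 (trans (sym (+-suc p e)) eq))
letter-alt01 (suc m) zero e eq
  rewrite trans (suc-injective eq) (+-suc m m) = sym (isEven-odd m)
letter-alt01 (suc m) (suc zero) e eq
  rewrite suc-injective (trans (suc-injective eq) (+-suc m m)) = sym (isEven-even m)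
letter-alt01 (suc m) (suc (suc p)) e eq =
  letter-alt01 m p e (suc-injective (trans (suc-injective eq) (+-suc m m)))

letter-A : ∀ M p e → 0 < p → p + suc e ≡ M → letter (antiRegularString M) p ≡ isEven e
letter-A M p e 0<p eq with parity M
... | even m rewrite ars-even m = letter-alt01 m p e eq
letter-A M (suc p) e 0<p eq | odd m rewrite ars-odd m = letter-alt01 m p e (suc-injective eq)

half-≤ : ∀ {q r} → q + q ≤ r + r → q ≤ r
half-≤ le = ≮⇒≥ (λ r<q → <⇒≱ (+-mono-< r<q r<q) le)

half-< : ∀ {q r} → q + q < r + r → q < r
half-< lt = ≰⇒> (λ r≤q → <⇒≱ lt (+-mono-≤ r≤q r≤q))

-- Going backwards from the end, the vertices alternately receive the
-- largest and the smallest weights not used yet: M, 1, M-1, 2, ...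
weightByParity : ℕ → ∀ {e} → Parity e → ℕ
weightByParity M (even r) = M ∸ r
weightByParity M (odd r)  = suc r

distanceWeight : ℕ → ℕ → ℕ
distanceWeight M e = weightByParity M (parity e)

distanceWeight-positive : ∀ {M e} → e < M → 1 ≤ distanceWeight M e
distanceWeight-positive {M} {e} e<M with parity e
... | even r = m<n⇒0<n∸m (≤-<-trans (m≤m+n r r) e<M)
... | odd r  = s≤s z≤n

distanceWeight-bounded : ∀ {M e} → e < M → distanceWeight M e ≤ M
distanceWeight-bounded {M} {e} e<M with parity e
... | even r = m∸n≤m M r
... | odd r  = ≤-trans (s≤s (m≤m+n r r)) (<⇒≤ e<M)

large≢small : ∀ {M r q} → r + r < M → suc (q + q) < M → M ∸ r ≡ suc q → ⊥
large≢small {M} {r} {q} lt lt' eq = <⇒≱ q<r r≤q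
  where
  M≡ : suc q + r ≡ M
  M≡ = trans (cong (_+ r) (sym eq)) (m∸n+n≡m (≤-trans (m≤m+n r r) (<⇒≤ lt)))
  r≤q : r ≤ q
  r≤q = s≤s⁻¹ (+-cancelʳ-< r r (suc q) (subst (r + r <_) (sym M≡) lt))
  q<r : q < r
  q<r = +-cancelˡ-< q q r (s≤s⁻¹ (subst (suc (q + q) <_) (sym M≡) lt'))

distanceWeight-injective : ∀ {M e e'} → e < M → e' < M →
  distanceWeight M e ≡ distanceWeight M e' → e ≡ e'
distanceWeight-injective {M} {e} {e'} e<M e'<M eq with parity e | parity e'
... | even r | even q = cong (λ x → x + x) (∸-cancelˡ-≡ (half≤ r e<M) (half≤ q e'<M) eq)
  where
  half≤ : ∀ r → r + r < M → r ≤ M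
  half≤ r lt = ≤-trans (m≤m+n r r) (<⇒≤ lt)
... | odd r  | odd q  = cong (λ x → suc (x + x)) (suc-injective eq)
... | even r | odd q  = ⊥-elim (large≢small {M} {r} {q} e<M e'<M eq)
... | odd r  | even q = ⊥-elim (large≢small {M} {q} {r} e'<M e<M (sym eq))

isEven-odd≢true : ∀ q → isEven (suc (q + q)) ≢ true
isEven-odd≢true q t with trans (sym t) (isEven-odd q)
... | ()

-- A pair of vertices at distances e' < e from the end is heavy (weights sum
-- beyond M) exactly when e' is even, i.e. when the later vertex is a 1.
distanceWeight-threshold : ∀ {M e e'} → e' < e → e < M →
  isEven e' ≡ true ⇔ M < distanceWeight M e + distanceWeight M e'
distanceWeight-threshold {M} {e} {e'} e'<e e<M with parity e | parity e'
... | even r | even q = mk⇔ (λ _ → large+large) (λ _ → isEven-even q)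
  where
  open ≤-Reasoning
  r≤M : r ≤ M
  r≤M = ≤-trans (m≤m+n r r) (<⇒≤ e<M)
  r<M∸q : r < M ∸ q
  r<M∸q = +-cancelˡ-< q r (M ∸ q) (begin-strict
    q + r       <⟨ +-monoˡ-< r (half-< e'<e) ⟩
    r + r       <⟨ e<M ⟩
    M           ≡⟨ m+[n∸m]≡n (≤-trans (m≤m+n q q) (<⇒≤ (<-trans e'<e e<M))) ⟨
    q + (M ∸ q) ∎)
  large+large : M < (M ∸ r) + (M ∸ q)
  large+large = begin-strict
    M               ≡⟨ m∸n+n≡m r≤M ⟨
    (M ∸ r) + r     <⟨ +-monoʳ-< (M ∸ r) r<M∸q ⟩
    (M ∸ r) + (M ∸ q) ∎
... | odd r  | even q = mk⇔ (λ _ → small+large) (λ _ → isEven-even q)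
  where
  open ≤-Reasoning
  small+large : M < suc r + (M ∸ q)
  small+large = begin-strict
    M           ≡⟨ m+[n∸m]≡n (≤-trans (m≤m+n q q) (<⇒≤ (<-trans e'<e e<M))) ⟨
    q + (M ∸ q) ≤⟨ +-monoˡ-≤ (M ∸ q) (half-≤ (s≤s⁻¹ e'<e)) ⟩
    r + (M ∸ q) <⟨ n<1+n _ ⟩
    suc r + (M ∸ q) ∎
... | even r | odd q  = mk⇔ (λ t → ⊥-elim (isEven-odd≢true q t)) (λ h → ⊥-elim (<⇒≱ h large+small))
  where
  open ≤-Reasoning
  large+small : (M ∸ r) + suc q ≤ M
  large+small = begin
    (M ∸ r) + suc q ≤⟨ +-monoʳ-≤ (M ∸ r) (half-< (<-trans (n<1+n _) e'<e)) ⟩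
    (M ∸ r) + r     ≡⟨ m∸n+n≡m (≤-trans (m≤m+n r r) (<⇒≤ e<M)) ⟩
    M               ∎
... | odd r  | odd q  = mk⇔ (λ t → ⊥-elim (isEven-odd≢true q t)) (λ h → ⊥-elim (<⇒≱ h small+small))
  where
  open ≤-Reasoning
  small+small : suc r + suc q ≤ M
  small+small = begin
    suc r + suc q  ≤⟨ +-monoʳ-≤ (suc r) (half-< (s≤s⁻¹ e'<e)) ⟩
    suc (r + r)    ≤⟨ <⇒≤ e<M ⟩
    M              ∎

distance : ℕ → ℕ → ℕ
distance M p = M ∸ suc p

distance-< : ∀ {M p} → p < M → distance M p < M
distance-< p<M = ∸-monoʳ-< z<s p<M

distance-anti : ∀ {M i j} → i < j → j < M → distance M j < distance M i
distance-anti i<j j<M = ∸-monoʳ-< (s≤s i<j) j<M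

distance-injective : ∀ {M i j} → i < M → j < M → distance M i ≡ distance M j → i ≡ j
distance-injective i<M j<M eq = suc-injective (∸-cancelˡ-≡ i<M j<M eq)

distance-sum : ∀ {M p} → p < M → p + suc (distance M p) ≡ M
distance-sum {M} {p} p<M = trans (+-suc p (M ∸ suc p)) (m+[n∸m]≡n p<M)

positionWeight : ℕ → ℕ → ℕ
positionWeight M p = distanceWeight M (distance M p)

A-ordered : ∀ {M i j} → i < j → j < M →
  linked (antiRegularString M) i j ≡ true ⇔ M < positionWeight M i + positionWeight M j
A-ordered {M} {i} {j} i<j j<M
  rewrite linked-< (antiRegularString M) i<j
        | letter-A M j (distance M j) (≤-<-trans z≤n i<j) (distance-sum j<M)
  = distanceWeight-threshold (distance-anti i<j j<M) (distance-< (<-trans i<j j<M))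

A-linked⇔heavy : ∀ {M i j} → i < M → j < M → i ≢ j →
  linked (antiRegularString M) i j ≡ true ⇔ M < positionWeight M i + positionWeight M j
A-linked⇔heavy {M} {i} {j} i<M j<M i≢j with <-cmp i j
... | tri< i<j _ _ = A-ordered i<j j<M
... | tri≈ _ i≡j _ = ⊥-elim (i≢j i≡j)
... | tri> _ _ j<i rewrite +-comm (positionWeight M i) (positionWeight M j)
                         | linked-> (antiRegularString M) j<i
                         | sym (linked-< (antiRegularString M) j<i) = A-ordered j<i i<M

record WeightRealization (G : Graph) (M : ℕ) : Set where
  field
    weight           : Fin (size G) → ℕ
    weight-injective : ∀ {u v} → weight u ≡ weight v → u ≡ v
    weight-positive  : ∀ u → 1 ≤ weight u
    weight-bounded   : ∀ u → weight u ≤ M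
    adjacent⇒heavy   : ∀ {u v} → u ≢ v → adj G u v ≡ true → M < weight u + weight v
    heavy⇒adjacent   : ∀ {u v} → u ≢ v → M < weight u + weight v → adj G u v ≡ true

restrict : ∀ {G H M} → G ↪ H → WeightRealization H M → WeightRealization G M
restrict (f , f-injective , f-adj) R = record
  { weight           = λ u → weight (f u)
  ; weight-injective = λ eq → f-injective (weight-injective eq)
  ; weight-positive  = λ u → weight-positive (f u)
  ; weight-bounded   = λ u → weight-bounded (f u)
  ; adjacent⇒heavy   = λ u≢v a → adjacent⇒heavy (distinct u≢v) (trans (sym (f-adj _ _)) a)
  ; heavy⇒adjacent   = λ u≢v h → trans (f-adj _ _) (heavy⇒adjacent (distinct u≢v) h)
  }
  where
  open WeightRealization R

  distinct : ∀ {u v} → u ≢ v → f u ≢ f v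
  distinct u≢v eq = u≢v (f-injective eq)

A-realization : ∀ M → WeightRealization (A M) M
A-realization M = record
  { weight           = λ u → positionWeight M (toℕ u)
  ; weight-injective = λ {u} {v} eq → toℕ-injective (distance-injective (in-range u) (in-range v)
                         (distanceWeight-injective (distance-< (in-range u)) (distance-< (in-range v)) eq))
  ; weight-positive  = λ u → distanceWeight-positive (distance-< (in-range u))
  ; weight-bounded   = λ u → distanceWeight-bounded (distance-< (in-range u))
  ; adjacent⇒heavy   = λ {u} {v} u≢v a →
      Equivalence.to (A-linked⇔heavy (in-range u) (in-range v) (distinct u≢v))
                     (trans (sym (adj≡linked c u v)) a)
  ; heavy⇒adjacent   = λ {u} {v} u≢v h →
      trans (adj≡linked c u v) (Equivalence.from (A-linked⇔heavy (in-range u) (in-range v) (distinct u≢v)) h)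
  }
  where
  c = antiRegularString M

  in-range : ∀ (u : Fin (length c)) → toℕ u < M
  in-range u = subst (toℕ u <_) (size-A M) (toℕ<n u)

  distinct : ∀ {u v : Fin (length c)} → u ≢ v → toℕ u ≢ toℕ v
  distinct u≢v eq = u≢v (toℕ-injective eq)

injective-below⇒≤ : ∀ {m B} (h : Fin m → ℕ) → (∀ i → h i < B) →
  (∀ {i j} → h i ≡ h j → i ≡ j) → m ≤ B
injective-below⇒≤ h below h-injective = injective⇒≤ {f = λ i → fromℕ< (below i)} λ {i} {j} eq →
  h-injective (trans (sym (toℕ-fromℕ< (below i))) (trans (cong toℕ eq) (toℕ-fromℕ< (below j))))

-- Then 2n ≤ M + K + 1.
-- The 2n numbers W(u) - 1 and, for each v, either M - W(v) (when no vertex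
-- has weight M + 1 - W(v)), or M + class(v) (when v is lightest in its
-- class), or M + K, are pairwise distinct and below M + K + 1.
module TwinCounting {G : Graph} {M K : ℕ} (R : WeightRealization G M)
  (class : Fin (size G) → Fin K)
  (twins : ∀ {u v x} → class u ≡ class v → x ≢ u → x ≢ v → adj G x u ≡ adj G x v)
  where

  open WeightRealization R renaming (weight to W)

  V : Set
  V = Fin (size G)

  no-separation : ∀ {u v x} → class u ≡ class v → x ≢ u → x ≢ v →
                  M < W x + W v → W x + W u ≤ M → ⊥
  no-separation c x≢u x≢v heavy light =
    <⇒≱ (adjacent⇒heavy x≢u (trans (twins c x≢u x≢v) (heavy⇒adjacent x≢v heavy))) light

  Partnered : V → Set
  Partnered v = Σ V λ y → W y + W v ≡ suc M

  Lightest : V → Set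
  Lightest v = ∀ y → class y ≡ class v → W v ≤ W y

  Dominated : V → Set
  Dominated v = Σ V λ u → class u ≡ class v × W u < W v

  partner-is-twin : ∀ {u v y} → class u ≡ class v → W u < W v → W y + W v ≡ suc M →
                    y ≡ u ⊎ y ≡ v
  partner-is-twin {u} {v} {y} c u<v eq with y ≟ᶠ u | y ≟ᶠ v
  ... | yes y≡u | _       = inj₁ y≡u
  ... | no _    | yes y≡v = inj₂ y≡v
  ... | no y≢u  | no y≢v  = ⊥-elim (no-separation c y≢u y≢v
                               (≤-reflexive (sym eq))
                               (s≤s⁻¹ (subst (W y + W u <_) eq (+-monoʳ-< (W y) u<v))))

  dominated-heavy : ∀ {v} → Dominated v → Partnered v → suc M ≤ W v + W v
  dominated-heavy {v} (u , c , u<v) (y , eq) with partner-is-twin c u<v eq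
  ... | inj₁ refl = subst (_≤ W v + W v) eq (<⇒≤ (+-monoˡ-< (W v) u<v))
  ... | inj₂ refl = ≤-reflexive (sym eq)

  dominated-unequal : ∀ {v v'} → Dominated v → Partnered v → Dominated v' → Partnered v' →
                      W v < W v' → ⊥
  dominated-unequal {v} {v'} dom pv (u' , c' , u'<v') (y' , eq') v<v'
    with partner-is-twin c' u'<v' eq'
  ... | inj₂ refl = <⇒≱ (+-mono-< v<v' v<v') (≤-trans (≤-reflexive eq') (dominated-heavy dom pv))
  ... | inj₁ refl with v ≟ᶠ u'
  ...   | yes refl = <⇒≱ (+-monoʳ-< (W v) v<v') (≤-trans (≤-reflexive eq') (dominated-heavy dom pv))
  ...   | no v≢u'  = no-separation c' v≢u' (λ eq → <-irrefl (cong W eq) v<v')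
                       (<-≤-trans (dominated-heavy dom pv) (+-monoʳ-≤ (W v) (<⇒≤ v<v')))
                       (s≤s⁻¹ (subst (W v + W u' <_) (trans (+-comm (W v') (W u')) eq')
                                       (+-monoˡ-< (W u') v<v')))

  dominated-unique : ∀ {v v'} → Dominated v → Partnered v → Dominated v' → Partnered v' → v ≡ v'
  dominated-unique {v} {v'} d p d' p' with <-cmp (W v) (W v')
  ... | tri< v<v' _ _ = ⊥-elim (dominated-unequal d p d' p' v<v')
  ... | tri≈ _ eq _   = weight-injective eq
  ... | tri> _ _ v'<v = ⊥-elim (dominated-unequal d' p' d p v'<v)

  -- The three kinds of vertices, which receive labels in disjoint ranges.
  data Kind (v : V) : Set where
    unpartnered : ¬ Partnered v → Kind v
    lightest    : Lightest v → Kind v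
    dominated   : Partnered v → Dominated v → Kind v

  kind : ∀ v → Kind v
  kind v with any? (λ y → W y + W v ≟ suc M)
  ... | no unpartnered-v = unpartnered unpartnered-v
  ... | yes partnered-v with all? (λ y → (class y ≟ᶠ class v) →-dec (W v ≤? W y))
  ...   | yes lightest-v = lightest λ y c → lightest-v y c
  ...   | no not-lightest with ¬∀⟶∃¬ _ _ (λ y → (class y ≟ᶠ class v) →-dec (W v ≤? W y)) not-lightest
  ...     | y , not-above = dominated partnered-v (y , same-class , ≰⇒> (λ le → not-above (λ _ → le)))
    where
    same-class : class y ≡ class v
    same-class with class y ≟ᶠ class v
    ... | yes c = c
    ... | no c  = ⊥-elim (not-above (λ c' → ⊥-elim (c c')))

  label : ∀ {v} → Kind v → ℕ
  label {v} (unpartnered _) = M ∸ W v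
  label {v} (lightest _)    = M + toℕ (class v)
  label     (dominated _ _) = M + K

  unpartnered-label<M : ∀ v → M ∸ W v < M
  unpartnered-label<M v = ∸-monoʳ-< (weight-positive v) (weight-bounded v)

  below-M≢above : ∀ {x y} → x < M → x ≢ M + y
  below-M≢above {x} {y} x<M eq = <⇒≱ x<M (subst (M ≤_) (sym eq) (m≤m+n M y))

  label-injective : ∀ {v v'} (k : Kind v) (k' : Kind v') → label k ≡ label k' → v ≡ v'
  label-injective {v} {v'} (unpartnered _) (unpartnered _) eq =
    weight-injective (∸-cancelˡ-≡ (weight-bounded v) (weight-bounded v') eq)
  label-injective {v} {v'} (lightest l) (lightest l') eq =
    weight-injective (≤-antisym (l v' (sym same-class)) (l' v same-class))
    where
    same-class : class v ≡ class v'
    same-class = toℕ-injective (+-cancelˡ-≡ M _ _ eq)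
  label-injective (dominated p d) (dominated p' d') _ = dominated-unique d p d' p'
  label-injective {v} (unpartnered _) (lightest _)    eq = ⊥-elim (below-M≢above (unpartnered-label<M v) eq)
  label-injective {v} (unpartnered _) (dominated _ _) eq = ⊥-elim (below-M≢above (unpartnered-label<M v) eq)
  label-injective {_} {v'} (lightest _)    (unpartnered _) eq =
    ⊥-elim (below-M≢above (unpartnered-label<M v') (sym eq))
  label-injective {_} {v'} (dominated _ _) (unpartnered _) eq =
    ⊥-elim (below-M≢above (unpartnered-label<M v') (sym eq))
  label-injective {v} (lightest _) (dominated _ _) eq =
    ⊥-elim (<-irrefl (+-cancelˡ-≡ M _ _ eq) (toℕ<n (class v)))
  label-injective {_} {v'} (dominated _ _) (lightest _) eq =
    ⊥-elim (<-irrefl (+-cancelˡ-≡ M _ _ (sym eq)) (toℕ<n (class v')))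

  label-below : ∀ {v} (k : Kind v) → label k < M + suc K
  label-below {v} (unpartnered _) = <-≤-trans (unpartnered-label<M v) (m≤m+n M (suc K))
  label-below {v} (lightest _)    = +-monoʳ-< M (m<n⇒m<1+n (toℕ<n (class v)))
  label-below     (dominated _ _) = +-monoʳ-< M (n<1+n K)

  lowered<M : ∀ u → W u ∸ 1 < M
  lowered<M u = <-≤-trans (∸-monoʳ-< z<s (weight-positive u)) (weight-bounded u)

  lowered≢label : ∀ {u v} (k : Kind v) → W u ∸ 1 ≢ label k
  lowered≢label {u} {v} (unpartnered none) eq = none (u , (begin
    W u + W v             ≡⟨ cong (_+ W v) (m∸n+n≡m (weight-positive u)) ⟨
    W u ∸ 1 + 1 + W v     ≡⟨ cong (λ x → x + 1 + W v) eq ⟩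
    M ∸ W v + 1 + W v     ≡⟨ cong (_+ W v) (+-comm (M ∸ W v) 1) ⟩
    suc (M ∸ W v + W v)   ≡⟨ cong suc (m∸n+n≡m (weight-bounded v)) ⟩
    suc M                 ∎))
    where open ≡-Reasoning
  lowered≢label {u} (lightest _)    eq = below-M≢above (lowered<M u) eq
  lowered≢label {u} (dominated _ _) eq = below-M≢above (lowered<M u) eq

  number : V ⊎ V → ℕ
  number (inj₁ u) = W u ∸ 1
  number (inj₂ v) = label (kind v)

  number-below : ∀ x → number x < M + suc K
  number-below (inj₁ u) = <-≤-trans (lowered<M u) (m≤m+n M (suc K))
  number-below (inj₂ v) = label-below (kind v)

  number-injective : ∀ {x y} → number x ≡ number y → x ≡ y
  number-injective {inj₁ u} {inj₁ u'} eq =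
    cong inj₁ (weight-injective (∸-cancelʳ-≡ (weight-positive u) (weight-positive u') eq))
  number-injective {inj₁ u} {inj₂ v}  eq = ⊥-elim (lowered≢label (kind v) eq)
  number-injective {inj₂ v} {inj₁ u}  eq = ⊥-elim (lowered≢label (kind v) (sym eq))
  number-injective {inj₂ v} {inj₂ v'} eq = cong inj₂ (label-injective (kind v) (kind v') eq)

  splitAt-injective : ∀ {i j : Fin (size G + size G)} →
                      splitAt (size G) i ≡ splitAt (size G) j → i ≡ j
  splitAt-injective {i} {j} eq = begin
    i                                       ≡⟨ join-splitAt (size G) (size G) i ⟨
    join (size G) (size G) (splitAt (size G) i) ≡⟨ cong (join (size G) (size G)) eq ⟩
    join (size G) (size G) (splitAt (size G) j) ≡⟨ join-splitAt (size G) (size G) j ⟩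
    j                                       ∎
    where open ≡-Reasoning

  twin-bound : size G + size G ≤ M + suc K
  twin-bound = injective-below⇒≤ (λ i → number (splitAt (size G) i))
                                 (λ i → number-below (splitAt (size G) i))
                 (λ {i} {j} eq → splitAt-injective {i} {j} (number-injective {splitAt _ i} {splitAt _ j} eq))

length-blocksString : ∀ bs → length (blocksString bs) ≡ blocksSize bs
length-blocksString [] = refl
length-blocksString ((s , t) ∷ bs) = begin
  length ((replicate s false ++ replicate t true) ++ blocksString bs)
    ≡⟨ length-++ (replicate s false ++ replicate t true) ⟩
  length (replicate s false ++ replicate t true) + length (blocksString bs)
    ≡⟨ cong₂ _+_ (trans (length-++ (replicate s false))
                        (cong₂ _+_ (length-replicate s) (length-replicate t)))
                 (length-blocksString bs) ⟩
  s + t + blocksSize bs ∎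
  where open ≡-Reasoning

letter-replicate-++ : ∀ s x r j →
  letter (replicate s x ++ r) j ≡ (if j <ᵇ s then x else letter r (j ∸ s))
letter-replicate-++ zero    x r zero    = refl
letter-replicate-++ zero    x r (suc j) = refl
letter-replicate-++ (suc s) x r zero    = refl
letter-replicate-++ (suc s) x r (suc j) = letter-replicate-++ s x r j

-- The index of the run (0^{s₁} is run 0, 1^{t₁} run 1, 0^{s₂} run 2, ...)
-- containing position j of the block string.
runIndex : List (ℕ × ℕ) → ℕ → ℕ
runIndex []             j = 0
runIndex ((s , t) ∷ bs) j =
  if j <ᵇ s then 0 else (if (j ∸ s) <ᵇ t then 1 else 2 + runIndex bs (j ∸ s ∸ t))

letter-blocks : ∀ bs j → letter (blocksString bs) j ≡ not (isEven (runIndex bs j))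
letter-blocks [] j = refl
letter-blocks ((s , t) ∷ bs) j
  rewrite ++-assoc (replicate s false) (replicate t true) (blocksString bs)
        | letter-replicate-++ s false (replicate t true ++ blocksString bs) j
        | letter-replicate-++ t true (blocksString bs) (j ∸ s)
  with j <ᵇ s | (j ∸ s) <ᵇ t
... | true  | _     = refl
... | false | true  = refl
... | false | false = letter-blocks bs (j ∸ s ∸ t)

data Region (s t j : ℕ) : Set where
  in-zeros : j < s → Region s t j
  in-ones  : s ≤ j → j ∸ s < t → Region s t j
  beyond   : s ≤ j → t ≤ j ∸ s → Region s t j

region : ∀ s t j → Region s t j
region s t j with j <? s
... | yes j<s = in-zeros j<s
... | no j≮s with (j ∸ s) <? t
...   | yes j-s<t = in-ones (≮⇒≥ j≮s) j-s<t
...   | no j-s≮t  = beyond (≮⇒≥ j≮s) (≮⇒≥ j-s≮t)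

runIndex-zeros : ∀ {s t bs j} → j < s → runIndex ((s , t) ∷ bs) j ≡ 0
runIndex-zeros j<s rewrite <ᵇ-true j<s = refl

runIndex-ones : ∀ {s t bs j} → s ≤ j → j ∸ s < t → runIndex ((s , t) ∷ bs) j ≡ 1
runIndex-ones s≤j j-s<t rewrite <ᵇ-false s≤j | <ᵇ-true j-s<t = refl

runIndex-beyond : ∀ {s t bs j} → s ≤ j → t ≤ j ∸ s →
                  runIndex ((s , t) ∷ bs) j ≡ 2 + runIndex bs (j ∸ s ∸ t)
runIndex-beyond s≤j t≤j-s rewrite <ᵇ-false s≤j | <ᵇ-false t≤j-s = refl

runIndex-mono : ∀ bs {i j} → i ≤ j → runIndex bs i ≤ runIndex bs j
runIndex-mono []             _   = z≤n
runIndex-mono ((s , t) ∷ bs) {i} {j} i≤j with region s t i | region s t j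
... | in-zeros p   | _ rewrite runIndex-zeros {s} {t} {bs} p = z≤n
... | in-ones p _  | in-zeros p' = ⊥-elim (<⇒≱ p' (≤-trans p i≤j))
... | beyond p _   | in-zeros p' = ⊥-elim (<⇒≱ p' (≤-trans p i≤j))
... | in-ones p q  | in-ones p' q'
  rewrite runIndex-ones {s} {t} {bs} p q | runIndex-ones {s} {t} {bs} p' q' = ≤-refl
... | in-ones p q  | beyond p' q'
  rewrite runIndex-ones {s} {t} {bs} p q | runIndex-beyond {s} {t} {bs} p' q' = s≤s z≤n
... | beyond p q   | in-ones p' q' = ⊥-elim (<⇒≱ q' (≤-trans q (∸-monoˡ-≤ s i≤j)))
... | beyond p q   | beyond p' q'
  rewrite runIndex-beyond {s} {t} {bs} p q | runIndex-beyond {s} {t} {bs} p' q' =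
  s≤s (s≤s (runIndex-mono bs (∸-monoˡ-≤ t (∸-monoˡ-≤ s i≤j))))

runIndex-bound : ∀ bs j → j < blocksSize bs → runIndex bs j < 2 * length bs
runIndex-bound []             j ()
runIndex-bound ((s , t) ∷ bs) j j<n rewrite *-suc 2 (length bs) with region s t j
... | in-zeros p rewrite runIndex-zeros {s} {t} {bs} p = z<s
... | in-ones p q rewrite runIndex-ones {s} {t} {bs} p q = s<s z<s
... | beyond p q rewrite runIndex-beyond {s} {t} {bs} p q = s<s (s<s (runIndex-bound bs _ in-rest))
  where
  shift : ∀ {a j X} → a ≤ j → j < a + X → j ∸ a < X
  shift {a} {j} {X} a≤j j<a+X =
    +-cancelˡ-< a (j ∸ a) X (subst (_< a + X) (sym (m+[n∸m]≡n a≤j)) j<a+X)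
  in-rest : j ∸ s ∸ t < blocksSize bs
  in-rest = shift q (shift p (subst (j <_) (+-assoc s t (blocksSize bs)) j<n))

-- The twin class of a position: its run, except that position 0 joins the
-- run of position 1 (the first letter of a threshold string is irrelevant).
twinClass : List (ℕ × ℕ) → ℕ → ℕ
twinClass bs zero    = runIndex bs 1
twinClass bs (suc j) = runIndex bs (suc j)

twinClass≤runIndex : ∀ bs {i x} → i ≤ x → 1 ≤ x → twinClass bs i ≤ runIndex bs x
twinClass≤runIndex bs {zero}  _   1≤x = runIndex-mono bs 1≤x
twinClass≤runIndex bs {suc i} i≤x _   = runIndex-mono bs i≤x

twinClass-pos : ∀ bs {j} → 1 ≤ j → twinClass bs j ≡ runIndex bs j
twinClass-pos bs {suc j} _ = refl

twinClass-bound : ∀ bs {j} → 1 < blocksSize bs → j < blocksSize bs → twinClass bs j < 2 * length bs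
twinClass-bound bs {zero}  1<n _   = runIndex-bound bs 1 1<n
twinClass-bound bs {suc j} _   j<n = runIndex-bound bs (suc j) j<n

module _ (bs : List (ℕ × ℕ)) where
  private
    b : List Bool
    b = blocksString bs

  same-letter : ∀ {x y z j} → x < j → linked b x z ≡ letter b y →
                runIndex bs y ≡ runIndex bs j → linked b x z ≡ linked b x j
  same-letter {x} {y} {z} {j} x<j lz run = begin
    linked b x z                  ≡⟨ lz ⟩
    letter b y                    ≡⟨ letter-blocks bs y ⟩
    not (isEven (runIndex bs y))  ≡⟨ cong (λ r → not (isEven r)) run ⟩
    not (isEven (runIndex bs j))  ≡⟨ letter-blocks bs j ⟨
    letter b j                    ≡⟨ linked-< b x<j ⟨
    linked b x j                  ∎
    where open ≡-Reasoning

  twins-ordered : ∀ {i j x} → i < j → twinClass bs i ≡ twinClass bs j → x ≢ i → x ≢ j →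
                  linked b x i ≡ linked b x j
  twins-ordered {i} {j} {x} i<j same x≢i x≢j with <-cmp x i | <-cmp x j
  ... | tri≈ _ x≡i _ | _            = ⊥-elim (x≢i x≡i)
  ... | _            | tri≈ _ x≡j _ = ⊥-elim (x≢j x≡j)
  ... | _            | tri> _ _ j<x = trans (linked-> b (<-trans i<j j<x)) (sym (linked-> b j<x))
  ... | tri> _ _ i<x | tri< x<j _ _ = same-letter {z = i} x<j (linked-> b i<x) same-run
    where
    -- x lies between i and j, so it is in their common run.
    same-run : runIndex bs x ≡ runIndex bs j
    same-run = ≤-antisym (runIndex-mono bs (<⇒≤ x<j))
      (subst (_≤ runIndex bs x) (trans same (twinClass-pos bs (≤-<-trans z≤n i<j)))
             (twinClass≤runIndex bs (<⇒≤ i<x) (≤-<-trans z≤n i<x)))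
  ... | tri< x<i _ _ | tri< x<j _ _ = same-letter {z = i} x<j (linked-< b x<i) same-run
    where
    same-run : runIndex bs i ≡ runIndex bs j
    same-run = trans (sym (twinClass-pos bs (≤-<-trans z≤n x<i)))
                     (trans same (twinClass-pos bs (≤-<-trans z≤n x<j)))


  twins : ∀ {i j x} → twinClass bs i ≡ twinClass bs j → x ≢ i → x ≢ j →
          linked b x i ≡ linked b x j
  twins {i} {j} same x≢i x≢j with <-cmp i j
  ... | tri< i<j _ _  = twins-ordered i<j same x≢i x≢j
  ... | tri≈ _ refl _ = refl
  ... | tri> _ _ j<i  = sym (twins-ordered j<i (sym same) x≢j x≢i)

G↪A⇒bound : ∀ bs M K (cl : ℕ → ℕ) → (∀ j → j < blocksSize bs → cl j < K) →
  (∀ {i j} → cl i ≡ cl j → twinClass bs i ≡ twinClass bs j) →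
  thresholdGraph (blocksString bs) ↪ A M → blocksSize bs + blocksSize bs ≤ M + suc K
G↪A⇒bound bs M K cl cl-below cl-twin G↪A =
  subst (λ n → n + n ≤ M + suc K) (length-blocksString bs)
        (TwinCounting.twin-bound (restrict G↪A (A-realization M)) class class-twins)
  where
  b = blocksString bs

  in-range : ∀ (u : Fin (length b)) → toℕ u < blocksSize bs
  in-range u = subst (toℕ u <_) (length-blocksString bs) (toℕ<n u)

  class : Fin (length b) → Fin K
  class u = fromℕ< (cl-below (toℕ u) (in-range u))

  same-twinClass : ∀ {u v} → class u ≡ class v → twinClass bs (toℕ u) ≡ twinClass bs (toℕ v)
  same-twinClass {u} {v} eq = cl-twin (begin
    cl (toℕ u)       ≡⟨ toℕ-fromℕ< (cl-below (toℕ u) (in-range u)) ⟨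
    toℕ (class u)    ≡⟨ cong toℕ eq ⟩
    toℕ (class v)    ≡⟨ toℕ-fromℕ< (cl-below (toℕ v) (in-range v)) ⟩
    cl (toℕ v)       ∎)
    where open ≡-Reasoning

  class-twins : ∀ {u v x} → class u ≡ class v → x ≢ u → x ≢ v →
                adj (thresholdGraph b) x u ≡ adj (thresholdGraph b) x v
  class-twins {u} {v} {x} eq x≢u x≢v = begin
    adj (thresholdGraph b) x u  ≡⟨ adj≡linked b x u ⟩
    linked b (toℕ x) (toℕ u)    ≡⟨ twins bs (same-twinClass eq) (λ e → x≢u (toℕ-injective e))
                                                               (λ e → x≢v (toℕ-injective e)) ⟩
    linked b (toℕ x) (toℕ v)    ≡⟨ adj≡linked b x v ⟨
    adj (thresholdGraph b) x v  ∎
    where open ≡-Reasoning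

twice≡double : ∀ n → 2 * n ≡ n + n
twice≡double n = cong (n +_) (+-identityʳ n)

halve-bound : ∀ n k M → n + n ≤ M + 2 * k → 2 * (n ∸ k) ≤ M
halve-bound n k M le = begin
  2 * (n ∸ k)    ≡⟨ *-distribˡ-∸ 2 n k ⟩
  2 * n ∸ 2 * k  ≤⟨ m≤n+o⇒m∸n≤o (2 * n) (2 * k)
                      (subst₂ _≤_ (sym (twice≡double n)) (+-comm M (2 * k)) le) ⟩
  M              ∎
  where open ≤-Reasoning

halve-bound-1 : ∀ n k M → n + n ≤ M + suc (2 * k) → 2 * (n ∸ k) ∸ 1 ≤ M
halve-bound-1 n k M le = begin
  2 * (n ∸ k) ∸ 1      ≡⟨ cong (_∸ 1) (*-distribˡ-∸ 2 n k) ⟩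
  2 * n ∸ 2 * k ∸ 1    ≡⟨ ∸-+-assoc (2 * n) (2 * k) 1 ⟩
  2 * n ∸ (2 * k + 1)  ≤⟨ m≤n+o⇒m∸n≤o (2 * n) (2 * k + 1)
                            (subst₂ _≤_ (sym (twice≡double n)) M+suc≡ le) ⟩
  M                    ∎
  where
  open ≤-Reasoning
  M+suc≡ : M + suc (2 * k) ≡ 2 * k + 1 + M
  M+suc≡ = trans (+-comm M (suc (2 * k))) (cong (_+ M) (+-comm 1 (2 * k)))

-- For s₁ ≥ 2 there are 2k twin classes; for s₁ = 1 the first vertex joins
-- the class of the ones after it, and the classes 1, …, 2k - 1 remain.
A-minimal : ∀ s t rest → 1 ≤ s → 1 ≤ t → All ValidBlock rest → ∀ M →
  let bs = (s , t) ∷ rest in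
  thresholdGraph (blocksString bs) ↪ A M → targetN s (blocksSize bs) (length bs) ≤ M
A-minimal (suc zero) (suc t) rest _ _ _ M G↪A =
  halve-bound n k M (subst (λ K → n + n ≤ M + K) (suc-pred (2 * k))
    (G↪A⇒bound bs M (pred (2 * k)) (λ j → pred (twinClass bs j))
               below (λ {i} {j} → pred-twin {i} {j}) G↪A))
  where
  bs = (1 , suc t) ∷ rest
  n  = blocksSize bs
  k  = length bs

  class-positive : ∀ j → 1 ≤ twinClass bs j
  class-positive zero    = ≤-refl
  class-positive (suc j) = runIndex-mono bs {1} {suc j} (s≤s z≤n)

  below : ∀ j → j < n → pred (twinClass bs j) < pred (2 * k)
  below j j<n = pred-mono-< {{>-nonZero (class-positive j)}} (twinClass-bound bs (s≤s (s≤s z≤n)) j<n)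

  pred-twin : ∀ {i j} → pred (twinClass bs i) ≡ pred (twinClass bs j) →
              twinClass bs i ≡ twinClass bs j
  pred-twin {i} {j} = pred-injective {{>-nonZero (class-positive i)}} {{>-nonZero (class-positive j)}}
A-minimal (suc (suc s)) t rest _ _ _ M G↪A =
  halve-bound-1 n k M
    (G↪A⇒bound bs M (2 * k) (twinClass bs) (λ j → twinClass-bound bs (s≤s (s≤s z≤n))) (λ eq → eq) G↪A)
  where
  bs = (suc (suc s) , t) ∷ rest
  n  = blocksSize bs
  k  = length bs

theorem3p1 : (s₁ t₁ : ℕ) (rest : List (ℕ × ℕ)) →
    1 ≤ s₁ → 1 ≤ t₁ → All (λ p → 1 ≤ proj₁ p × 1 ≤ proj₂ p) rest →
    IsoToInducedSubgraph (thresholdGraph (blocksString ((s₁ , t₁) ∷ rest))) (A (2 * blocksSize ((s₁ , t₁) ∷ rest) ∸ 2))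
    × IsoToInducedSubgraph (thresholdGraph (blocksString ((s₁ , t₁) ∷ rest))) (A (targetN s₁ (blocksSize ((s₁ , t₁) ∷ rest)) (length ((s₁ , t₁) ∷ rest))))
    × (∀ M → 2 ≤ M → IsoToInducedSubgraph (thresholdGraph (blocksString ((s₁ , t₁) ∷ rest))) (A M) → targetN s₁ (blocksSize ((s₁ , t₁) ∷ rest)) (length ((s₁ , t₁) ∷ rest)) ≤ M)
theorem3p1 s₁ t₁ rest 1≤s₁ 1≤t₁ valid =
  ↪-trans {G} {A N} {A (2 * n ∸ 2)} G↪A-N (A-mono (targetN≤2n-2 s₁ n (length bs) (s≤s z≤n))) ,
  G↪A-N ,
  λ M _ → A-minimal s₁ t₁ rest 1≤s₁ 1≤t₁ valid M
  where
  bs  = (s₁ , t₁) ∷ rest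
  n   = blocksSize bs
  N   = targetN s₁ n (length bs)
  G   = thresholdGraph (blocksString bs)
  G↪A-N : G ↪ A N
  G↪A-N = G↪A-target s₁ t₁ rest 1≤s₁ 1≤t₁ valid
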